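{- Let $L$ be a bounded lattice and $\neg$ a protocomplementation on $L$. Then the map $a\mapsto\widehat{a}$ is (1) an embedding of $(L,\neg)$ into $(\mathfrak{L}(\mathsf{FI}(L,\neg)),\neg_\vartriangleleft)$ (an injective map preserving $0$, $1$, $\wedge$, $\vee$ and negation), and (2) an isomorphism from $L$ to the subalgebra of $(\mathfrak{L}(\mathsf{FI}(L,\neg)),\neg_\vartriangleleft)$ consisting of the $c_\vartriangleleft$-fixpoints that are compact open in the space $\mathsf{S}(L)$.
   Context: A protocomplementation is an antitone unary operation $\neg$ (i.e., $a\le b\Rightarrow\neg b\le\neg a$) with $a\wedge\neg a=0$ for all $a$ and $\neg0=1$. $\mathsf{FI}(L,\neg)=(X,\vartriangleleft)$ where $X$ is the set of pairs $(F,I)$ with $F$ a filter of $L$, $I$ an ideal of $L$, $F\cap I=\varnothing$, and $\{\neg a\mid a\in F\}\subseteq I$; and $(F,I)\vartriangleleft(F',I')$ iff $I\cap F'=\varnothing$. For $a\in L$, $\widehat{a}=\{(F,I)\in X\mid a\in F\}$. $\mathsf{S}(L)$ is $X$ with the topology generated by $\{\widehat{a}\mid a\in L\}$. For the frame $(X,\vartriangleleft)$ (write $y\vartriangleright x$ for $x\vartriangleleft y$): $c_\vartriangleleft(A)=\{x\mid\forall x'\vartriangleleft x\ \exists x''\vartriangleright x':x''\in A\}$; $\mathfrak{L}(X,\vartriangleleft)$ is the lattice of $c_\vartriangleleft$-fixpoints ($c_\vartriangleleft(A)=A$) ordered by inclusion, with meet $\cap$ and join $c_\vartriangleleft$ of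 the union; $\neg_\vartriangleleft A=\{x\mid\forall y\vartriangleleft x,\ y\notin A\}$. -}

module Defs where

open import Level using (Level; _⊔_; suc; Lift)
import Data.Empty as E
import Data.Unit as U
open import Data.Product using (Σ; ∃-syntax; _×_)
open import Data.List using (List)
open import Data.List.Relation.Unary.All using (All)
open import Data.List.Relation.Unary.Any using (Any)
open import Relation.Unary using (Pred; _∈_; _∉_; _⊆_; _∩_; _∪_; _≐_)
open import Relation.Binary.Lattice.Bundles using (BoundedLattice)

record Protocomplementation {c ℓ₁ ℓ₂} (L : BoundedLattice c ℓ₁ ℓ₂) : Set (c ⊔ ℓ₁ ⊔ ℓ₂) where
  open BoundedLattice L
  field
    ¬_        : Carrier → Carrier
    antitone  : ∀ {a b} → a ≤ b → (¬ b) ≤ (¬ a)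
    meet-zero : ∀ a → (a ∧ (¬ a)) ≈ ⊥
    neg-zero  : (¬ ⊥) ≈ ⊤

module FI {c ℓ₁ ℓ₂} (L : BoundedLattice c ℓ₁ ℓ₂) (N : Protocomplementation L) where
  open BoundedLattice L renaming (⊥ to 0L; ⊤ to 1L)
  open Protocomplementation N

  ℓ : Level
  ℓ = c ⊔ ℓ₁ ⊔ ℓ₂

  record IsFilter (F : Pred Carrier ℓ) : Set ℓ where
    field
      top∈ : 1L ∈ F
      up   : ∀ {a b} → a ≤ b → a ∈ F → b ∈ F
      meet : ∀ {a b} → a ∈ F → b ∈ F → (a ∧ b) ∈ F

  record IsIdeal (I : Pred Carrier ℓ) : Set ℓ where
    field
      bot∈ : 0L ∈ I
      down : ∀ {a b} → a ≤ b → b ∈ I → a ∈ I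
      join : ∀ {a b} → a ∈ I → b ∈ I → (a ∨ b) ∈ I

  record Point : Set (suc ℓ) where
    field
      F        : Pred Carrier ℓ
      I        : Pred Carrier ℓ
      isFilter : IsFilter F
      isIdeal  : IsIdeal I
      disjoint : ∀ z → z ∈ F → z ∈ I → E.⊥
      negF⊆I   : ∀ {a} → a ∈ F → (¬ a) ∈ I
  open Point

  X : Set (suc ℓ)
  X = Point

  _◁_ : X → X → Set ℓ
  p ◁ q = ∀ z → z ∈ I p → z ∈ F q → E.⊥

  Subset : Set (suc (suc ℓ))
  Subset = Pred X (suc ℓ)

  c◁ : Subset → Subset
  c◁ A x = ∀ x' → x' ◁ x → ∃[ x'' ] (x' ◁ x'' × x'' ∈ A)

  IsFixpoint : Subset → Set (suc ℓ)
  IsFixpoint A = c◁ A ≐ A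

  ¬◁ : Subset → Subset
  ¬◁ A x = ∀ y → y ◁ x → y ∉ A

  ∅X : Subset
  ∅X _ = Lift (suc ℓ) E.⊥

  0𝔏 : Subset
  0𝔏 = c◁ ∅X

  1𝔏 : Subset
  1𝔏 _ = Lift (suc ℓ) U.⊤

  _∧𝔏_ : Subset → Subset → Subset
  A ∧𝔏 B = A ∩ B

  _∨𝔏_ : Subset → Subset → Subset
  A ∨𝔏 B = c◁ (A ∪ B)

  hat : Carrier → Subset
  hat a x = Lift (suc ℓ) (a ∈ F x)

  -- the space S(L): topology on X generated by the sets â.
  -- Open sets of the generated topology: every point has a finite
  -- intersection of generators around it contained in the set.
  Basic : List Carrier → Subset
  Basic as x = Lift (suc ℓ) (All (λ a → a ∈ F x) as)

  IsOpen : Subset → Set (suc ℓ)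
  IsOpen V = ∀ x → x ∈ V → ∃[ as ] (x ∈ Basic as × Basic as ⊆ V)

  IsCompact : Subset → Set (suc (suc (suc ℓ)))
  IsCompact A =
    (J : Set (suc (suc ℓ))) (V : J → Subset) → (∀ j → IsOpen (V j)) →
    A ⊆ (λ x → ∃[ j ] x ∈ V j) →
    ∃[ js ] (A ⊆ (λ x → Any (λ j → x ∈ V j) js))

{-# OPTIONS --safe #-}
module Submission where

open import Defs
open import Level using (_⊔_; suc; Lift; lift; lower)
open import Data.Empty using (⊥-elim)
open import Data.Product using (_×_; ∃-syntax; _,_; proj₁; proj₂; Σ)
open import Data.Sum using (inj₁; inj₂)
open import Data.List as List using (List; []; _∷_; foldr)
open import Data.List.Relation.Unary.All as All using (All; []; _∷_)
import Data.List.Relation.Unary.All.Properties as Allₚ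
open import Data.List.Relation.Unary.Any using (Any; here; there)
import Data.List.Relation.Unary.Any.Properties as Anyₚ
open import Function using (_∘_)
open import Relation.Nullary.Decidable using (map′)
open import Relation.Unary using (_≐_; _⊆_; _∪_; _∈_; _∉_)
open import Relation.Binary.Lattice.Bundles using (BoundedLattice)
open import Axiom.ExcludedMiddle using (ExcludedMiddle)

-- Every point needed is principal: (↑a, ↓b) is a point whenever ∼a ≤ b and
-- a ≰ b. The cone (↑a, ↓∼a) lies in â and not in b̂ unless a ≤ b, so hat is
-- an order embedding. A point x outside â is ◁-above (↑1, ↓a), which sees no
-- point of â, so â is a c◁-fixpoint; similarly ∼a ∉ F x makes the cone of a a
-- ◁-predecessor of x inside â, which gives the negation. For joins, a point x'
-- with x' ◁ x and a ∨ b ∈ F x cannot have both a and b in its ideal, and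
-- a ∉ I x' makes x' ◁ the cone of a. Finally a compact open fixpoint is
-- covered by finitely many b̂ ⊆ A (a basic open is the hat of the meet of its
-- list), and closing their union under c◁ turns it into the hat of the join.

module Representation {c ℓ₁ ℓ₂} (L : BoundedLattice c ℓ₁ ℓ₂) (N : Protocomplementation L) where
  open BoundedLattice L renaming (⊥ to 0L; ⊤ to 1L)
  open Protocomplementation N renaming (¬_ to ∼_)
  open FI L N
  open Point
  open import Relation.Nullary using (¬_; Dec; yes; no)
  open IsFilter
  open IsIdeal

  ∼1≤0 : ∼ 1L ≤ 0L
  ∼1≤0 = trans (∧-greatest (maximum _) refl) (reflexive (meet-zero 1L))

  a≤∼a⇒a≤0 : ∀ {a} → a ≤ ∼ a → a ≤ 0L
  a≤∼a⇒a≤0 {a} a≤∼a = trans (∧-greatest refl a≤∼a) (reflexive (meet-zero a))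

  a≤0⇒1≤∼a : ∀ {a} → a ≤ 0L → 1L ≤ ∼ a
  a≤0⇒1≤∼a a≤0 = trans (reflexive (Eq.sym neg-zero)) (antitone a≤0)

  ≤-upward : ∀ x {a b} → a ≤ b → a ∈ F x → b ∈ F x
  ≤-upward x = up (isFilter x)

  0∉F : ∀ x → 0L ∉ F x
  0∉F x 0∈F = disjoint x 0L 0∈F (bot∈ (isIdeal x))

  principal : ∀ a b → ∼ a ≤ b → ¬ a ≤ b → X
  principal a b ∼a≤b a≰b = record
    { F        = λ z → Lift ℓ (a ≤ z)
    ; I        = λ z → Lift ℓ (z ≤ b)
    ; isFilter = record
      { top∈ = lift (maximum a)
      ; up   = λ z≤w (lift a≤z) → lift (trans a≤z z≤w)
      ; meet = λ (lift a≤z) (lift a≤w) → lift (∧-greatest a≤z a≤w)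
      }
    ; isIdeal  = record
      { bot∈ = lift (minimum b)
      ; down = λ z≤w (lift w≤b) → lift (trans z≤w w≤b)
      ; join = λ (lift z≤b) (lift w≤b) → lift (∨-least z≤b w≤b)
      }
    ; disjoint = λ z (lift a≤z) (lift z≤b) → a≰b (trans a≤z z≤b)
    ; negF⊆I   = λ (lift a≤z) → lift (trans (antitone a≤z) ∼a≤b)
    }

  principal-◁ : ∀ {a b} ∼a≤b a≰b x → b ∉ F x → principal a b ∼a≤b a≰b ◁ x
  principal-◁ _ _ x b∉F z (lift z≤b) z∈F = b∉F (≤-upward x z≤b z∈F)

  ◁-principal : ∀ {a b} ∼a≤b a≰b x → a ∉ I x → x ◁ principal a b ∼a≤b a≰b
  ◁-principal _ _ x a∉I z z∈I (lift a≤z) = a∉I (down (isIdeal x) a≤z z∈I)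

  cone-nontrivial : ∀ a → ¬ a ≤ 0L → ¬ a ≤ ∼ a
  cone-nontrivial a a≰0 a≤∼a = a≰0 (a≤∼a⇒a≤0 a≤∼a)

  cone : ∀ a → ¬ a ≤ 0L → X
  cone a a≰0 = principal a (∼ a) refl (cone-nontrivial a a≰0)

  cone-◁ : ∀ a a≰0 x → ∼ a ∉ F x → cone a a≰0 ◁ x
  cone-◁ a a≰0 = principal-◁ refl (cone-nontrivial a a≰0)

  ◁-cone : ∀ a a≰0 x → a ∉ I x → x ◁ cone a a≰0
  ◁-cone a a≰0 = ◁-principal refl (cone-nontrivial a a≰0)

  cone∈hat : ∀ a a≰0 → cone a a≰0 ∈ hat a
  cone∈hat a a≰0 = lift (lift refl)

  c◁-mono : ∀ {A B : Subset} → A ⊆ B → c◁ A ⊆ c◁ B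
  c◁-mono A⊆B x∈cA x' x'◁x with x∈cA x' x'◁x
  ... | x'' , x'◁x'' , x''∈A = x'' , x'◁x'' , A⊆B x''∈A

  c◁-inflationary : ∀ {A : Subset} → A ⊆ c◁ A
  c◁-inflationary {x = x} x∈A x' x'◁x = x , x'◁x , x∈A

  hat-∧ : ∀ a b → hat (a ∧ b) ≐ (hat a ∧𝔏 hat b)
  hat-∧ a b =
      (λ {x} (lift a∧b∈F) →
        lift (≤-upward x (x∧y≤x a b) a∧b∈F) , lift (≤-upward x (x∧y≤y a b) a∧b∈F))
    , λ {x} (lift a∈F , lift b∈F) → lift (meet (isFilter x) a∈F b∈F)

  hat-⊤ : hat 1L ≐ 1𝔏
  hat-⊤ = (λ _ → lift _) , λ {x} _ → lift (top∈ (isFilter x))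

  hat-⊥⊆ : ∀ {A : Subset} → hat 0L ⊆ A
  hat-⊥⊆ {x = x} (lift 0∈F) = ⊥-elim (0∉F x 0∈F)

  hat-∪⊆hat-∨ : ∀ a b → (hat a ∪ hat b) ⊆ hat (a ∨ b)
  hat-∪⊆hat-∨ a b {x} (inj₁ (lift a∈F)) = lift (≤-upward x (x≤x∨y a b) a∈F)
  hat-∪⊆hat-∨ a b {x} (inj₂ (lift b∈F)) = lift (≤-upward x (y≤x∨y a b) b∈F)

  hat-open : ∀ a → IsOpen (hat a)
  hat-open a x (lift a∈F) = (a ∷ []) , lift (a∈F ∷ []) , λ { (lift (a∈F' ∷ [])) → lift a∈F' }

  ⋀ : List Carrier → Carrier
  ⋀ = foldr _∧_ 1L

  Basic≐hat-⋀ : ∀ as → Basic as ≐ hat (⋀ as)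
  Basic≐hat-⋀ as = (λ {x} (lift as∈F) → lift (meets x as as∈F))
                 , (λ {x} (lift ⋀∈F) → lift (unmeets x as ⋀∈F))
    where
    meets : ∀ x as → All (_∈ F x) as → ⋀ as ∈ F x
    meets x []       []           = top∈ (isFilter x)
    meets x (b ∷ bs) (b∈F ∷ bs∈F) = meet (isFilter x) b∈F (meets x bs bs∈F)

    unmeets : ∀ x as → ⋀ as ∈ F x → All (_∈ F x) as
    unmeets x []       _ = []
    unmeets x (b ∷ bs) ⋀∈F =
      ≤-upward x (x∧y≤x _ _) ⋀∈F ∷ unmeets x bs (≤-upward x (x∧y≤y _ _) ⋀∈F)

  open⇒hat-neighbourhood : ∀ {A} → IsOpen A → ∀ {x} → x ∈ A → ∃[ b ] (x ∈ hat b × hat b ⊆ A)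
  open⇒hat-neighbourhood openA {x} x∈A with openA x x∈A
  ... | as , x∈Basic , Basic⊆A =
    ⋀ as , proj₁ (Basic≐hat-⋀ as) {x} x∈Basic
         , λ {y} y∈hat → Basic⊆A (proj₂ (Basic≐hat-⋀ as) {y} y∈hat)

  module Classical (em : ExcludedMiddle (suc (suc ℓ))) where

    decide : (P : Set ℓ) → Dec P
    decide P = map′ lower lift (em {Lift _ P})

    decide-≤ : ∀ a b → Dec (a ≤ b)
    decide-≤ a b = map′ lower lift (decide (Lift ℓ (a ≤ b)))

    hat-fixpoint : ∀ a → IsFixpoint (hat a)
    hat-fixpoint a = (λ {x} → c◁hat⊆hat {x}) , λ {x} → c◁-inflationary {hat a} {x}
      where
      c◁hat⊆hat : c◁ (hat a) ⊆ hat a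
      c◁hat⊆hat {x} x∈c with decide (a ∈ F x)
      ... | yes a∈F = lift a∈F
      ... | no  a∉F with x∈c (principal 1L a ∼1≤a 1≰a) (principal-◁ ∼1≤a 1≰a x a∉F)
        where
        ∼1≤a = trans ∼1≤0 (minimum a)
        1≰a = λ 1≤a → a∉F (≤-upward x 1≤a (top∈ (isFilter x)))
      ...   | _ , x'◁x'' , lift a∈F'' = ⊥-elim (x'◁x'' a (lift refl) a∈F'')

    hat-reflects-≤ : ∀ {a b} → hat a ⊆ hat b → a ≤ b
    hat-reflects-≤ {a} {b} â⊆b̂ with decide-≤ a 0L
    ... | yes a≤0 = trans a≤0 (minimum b)
    ... | no  a≰0 = lower (lower (â⊆b̂ {cone a a≰0} (cone∈hat a a≰0)))

    hat-injective : ∀ a b → hat a ≐ hat b → a ≈ b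
    hat-injective a b (â⊆b̂ , b̂⊆â) =
      antisym (hat-reflects-≤ (λ {x} → â⊆b̂ {x})) (hat-reflects-≤ (λ {x} → b̂⊆â {x}))

    hat-⊥ : hat 0L ≐ 0𝔏
    hat-⊥ = (λ {x} → hat-⊥⊆ {0𝔏} {x})
          , λ {x} x∈c → proj₁ (hat-fixpoint 0L) {x}
                          (c◁-mono {∅X} {hat 0L} (λ { {y} (lift ()) }) {x} x∈c)

    ∉I⇒◁-hat : ∀ x' a → a ∉ I x' → ∃[ x'' ] (x' ◁ x'' × x'' ∈ hat a)
    ∉I⇒◁-hat x' a a∉I = cone a a≰0 , ◁-cone a a≰0 x' a∉I , cone∈hat a a≰0
      where a≰0 = λ a≤0 → a∉I (down (isIdeal x') a≤0 (bot∈ (isIdeal x')))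

    hat-∨⊆ : ∀ a b → hat (a ∨ b) ⊆ c◁ (hat a ∪ hat b)
    hat-∨⊆ a b {x} (lift a∨b∈F) x' x'◁x with decide (a ∈ I x') | decide (b ∈ I x')
    ... | no a∉I | _ with ∉I⇒◁-hat x' a a∉I
    ...   | x'' , x'◁x'' , x''∈â = x'' , x'◁x'' , inj₁ x''∈â
    hat-∨⊆ a b {x} (lift a∨b∈F) x' x'◁x | yes _ | no b∉I with ∉I⇒◁-hat x' b b∉I
    ...   | x'' , x'◁x'' , x''∈b̂ = x'' , x'◁x'' , inj₂ x''∈b̂
    hat-∨⊆ a b {x} (lift a∨b∈F) x' x'◁x | yes a∈I | yes b∈I =
      ⊥-elim (x'◁x (a ∨ b) (join (isIdeal x') a∈I b∈I) a∨b∈F)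

    hat-∨ : ∀ a b → hat (a ∨ b) ≐ (hat a ∨𝔏 hat b)
    hat-∨ a b = (λ {x} → hat-∨⊆ a b {x})
              , λ {x} x∈c → proj₁ (hat-fixpoint (a ∨ b)) {x}
                              (c◁-mono {hat a ∪ hat b} {hat (a ∨ b)}
                                 (λ {y} → hat-∪⊆hat-∨ a b {y}) {x} x∈c)

    hat-¬ : ∀ a → hat (∼ a) ≐ ¬◁ (hat a)
    hat-¬ a = (λ (lift ∼a∈F) y y◁x (lift a∈F) → y◁x (∼ a) (negF⊆I y a∈F) ∼a∈F)
            , λ {x} → ¬◁⊆ {x}
      where
      ¬◁⊆ : ¬◁ (hat a) ⊆ hat (∼ a)
      ¬◁⊆ {x} x∈¬◁ with decide (∼ a ∈ F x) | decide-≤ a 0L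
      ... | yes ∼a∈F | _   = lift ∼a∈F
      ... | no  ∼a∉F | yes a≤0 =
        ⊥-elim (∼a∉F (≤-upward x (a≤0⇒1≤∼a a≤0) (top∈ (isFilter x))))
      ... | no  ∼a∉F | no a≰0 =
        ⊥-elim (x∈¬◁ (cone a a≰0) (cone-◁ a a≰0 x ∼a∉F) (cone∈hat a a≰0))

    hat-compact : ∀ a → IsCompact (hat a)
    hat-compact a J V openV cover with decide-≤ a 0L
    ... | yes a≤0 = [] , λ {x} (lift a∈F) → ⊥-elim (0∉F x (≤-upward x a≤0 a∈F))
    ... | no  a≰0 with cover (cone∈hat a a≰0)
    ...   | j , cone∈Vj with openV j (cone a a≰0) cone∈Vj
    ...     | as , lift as∈F , Basic⊆Vj =
      (j ∷ []) , λ {x} (lift a∈F) →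
        here (Basic⊆Vj (lift (All.map (λ (lift a≤b) → ≤-upward x a≤b a∈F) as∈F)))

    HatBelow : Subset → Set (suc (suc ℓ))
    HatBelow A = Lift (suc (suc ℓ)) (Σ Carrier λ b → hat b ⊆ A)

    generator : ∀ {A} → HatBelow A → Carrier
    generator = proj₁ ∘ lower

    ⋁ : List Carrier → Carrier
    ⋁ = foldr _∨_ 0L

    hat-⋁⊆ : ∀ {A} → IsFixpoint A → ∀ bs → All (λ b → hat b ⊆ A) bs → hat (⋁ bs) ⊆ A
    hat-⋁⊆ {A} fixA []       []           {x} = hat-⊥⊆ {A} {x}
    hat-⋁⊆ {A} fixA (b ∷ bs) (b̂⊆A ∷ bŝ⊆A) {x} x∈ĵ =
      proj₁ fixA {x}
        (c◁-mono {hat b ∪ hat (⋁ bs)} {A} (λ {y} → ∪⊆A {y}) {x} (hat-∨⊆ b (⋁ bs) {x} x∈ĵ))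
      where
      ∪⊆A : (hat b ∪ hat (⋁ bs)) ⊆ A
      ∪⊆A {y} (inj₁ y∈b̂) = b̂⊆A {y} y∈b̂
      ∪⊆A {y} (inj₂ y∈ĵ) = hat-⋁⊆ fixA bs bŝ⊆A {y} y∈ĵ

    hat-⋁⊇ : ∀ {x} bs → Any (λ b → x ∈ hat b) bs → x ∈ hat (⋁ bs)
    hat-⋁⊇ {x} (b ∷ bs) (here (lift b∈F)) = lift (≤-upward x (x≤x∨y _ _) b∈F)
    hat-⋁⊇ {x} (b ∷ bs) (there x∈bŝ) = lift (≤-upward x (y≤x∨y _ _) (lower (hat-⋁⊇ {x} bs x∈bŝ)))

    compact-open-fixpoint⇒hat : ∀ A → IsFixpoint A → IsOpen A → IsCompact A → ∃[ a ] (A ≐ hat a)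
    compact-open-fixpoint⇒hat A fixA openA compactA
      with compactA (HatBelow A) (hat ∘ generator) (hat-open ∘ generator) cover
      where
      cover : A ⊆ λ x → ∃[ j ] (x ∈ hat (generator j))
      cover x∈A with open⇒hat-neighbourhood openA x∈A
      ... | b , x∈b̂ , b̂⊆A = lift (b , b̂⊆A) , x∈b̂
    ... | js , subcover =
      ⋁ bs , (λ {x} x∈A → hat-⋁⊇ {x} bs (Anyₚ.map⁺ (subcover x∈A)))
           , hat-⋁⊆ fixA bs (Allₚ.map⁺ (All.universal (proj₂ ∘ lower) js))
      where
      bs = List.map generator js

theorem4p30 : ∀ {c ℓ₁ ℓ₂} (L : BoundedLattice c ℓ₁ ℓ₂) (N : Protocomplementation L) →
    ExcludedMiddle (suc (suc (c ⊔ ℓ₁ ⊔ ℓ₂))) →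
    let open BoundedLattice L
        open Protocomplementation N
        open FI L N
    in ((∀ a → IsFixpoint (hat a))
        × (∀ a b → hat a ≐ hat b → a ≈ b)
        × (hat ⊥ ≐ 0𝔏)
        × (hat ⊤ ≐ 1𝔏)
        × (∀ a b → hat (a ∧ b) ≐ (hat a ∧𝔏 hat b))
        × (∀ a b → hat (a ∨ b) ≐ (hat a ∨𝔏 hat b))
        × (∀ a → hat (¬ a) ≐ ¬◁ (hat a)))
       × ((∀ a → IsOpen (hat a) × IsCompact (hat a))
          × (∀ A → IsFixpoint A → IsOpen A → IsCompact A → ∃[ a ] (A ≐ hat a)))
theorem4p30 L N em =
    (hat-fixpoint , hat-injective , hat-⊥ , hat-⊤ , hat-∧ , hat-∨ , hat-¬)
  , (λ a → hat-open a , hat-compact a)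
  , compact-open-fixpoint⇒hat
  where
  open Representation L N
  open Classical em
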